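{- Let $k$ be a positive integer and $n\ge R(k,k)$. Then every $n\times n$ dissimilarity matrix with entries in $\{0,1\}$ has star tree rank at most $n-k+1$.
   Context: $R(k,k)$ is the Ramsey number: the least integer such that every graph on at least $R(k,k)$ vertices contains a clique or an independent set of size $k$. An $n\times n$ dissimilarity matrix is a function from 2-element subsets of $[n]$ to $\mathbb{R}$. A star tree matrix is one of the form $(v_i+v_j)_{i\ne j}$ for $v\in\mathbb{R}^n$; the star tree rank of $M$ is the least $r$ such that $M$ is the entrywise minimum of $r$ star tree matrices. -}

module Defs where

open import Data.Nat using (ℕ; zero; suc; _≤_; _∸_; _+_)
open import Data.Fin using (Fin; zero; suc)
open import Data.Bool using (Bool; true; false)
open import Data.Rational using (ℚ; 0ℚ; 1ℚ; _⊓_) renaming (_+_ to _+ℚ_)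
open import Data.Product using (Σ; ∃; _×_; _,_)
open import Data.Sum using (_⊎_)
open import Relation.Binary.PropositionalEquality using (_≡_; _≢_)
open import Function.Definitions using (Injective)

-- A simple graph on vertex set Fin m: symmetric Bool-valued adjacency
-- (diagonal values are irrelevant).
record Graph (m : ℕ) : Set where
  field
    adj : Fin m → Fin m → Bool
    adj-sym : ∀ i j → adj i j ≡ adj j i
open Graph public

HasClique : ∀ {m} → Graph m → ℕ → Set
HasClique {m} G k = Σ (Fin k → Fin m) λ f →
  Injective _≡_ _≡_ f × (∀ a b → a ≢ b → adj G (f a) (f b) ≡ true)

HasIndep : ∀ {m} → Graph m → ℕ → Set
HasIndep {m} G k = Σ (Fin k → Fin m) λ f →
  Injective _≡_ _≡_ f × (∀ a b → a ≢ b → adj G (f a) (f b) ≡ false)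

RamseyProperty : ℕ → ℕ → Set
RamseyProperty k N = ∀ m → N ≤ m → (G : Graph m) → HasClique G k ⊎ HasIndep G k

IsRamseyNumber : ℕ → ℕ → Set
IsRamseyNumber k R = RamseyProperty k R × (∀ N → RamseyProperty k N → R ≤ N)

-- An n×n dissimilarity matrix: a symmetric function on pairs; only
-- off-diagonal entries (2-element subsets) are meaningful.
record Dissim (n : ℕ) : Set where
  field
    ent : Fin n → Fin n → ℚ
    ent-sym : ∀ i j → ent i j ≡ ent j i
open Dissim public

ZeroOne : ∀ {n} → Dissim n → Set
ZeroOne {n} M = ∀ (i j : Fin n) → i ≢ j → (ent M i j ≡ 0ℚ) ⊎ (ent M i j ≡ 1ℚ)

minFin : ∀ {s} → (Fin (suc s) → ℚ) → ℚ
minFin {zero} f = f zero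
minFin {suc s} f = f zero ⊓ minFin (λ t → f (suc t))

-- star tree matrix of v: entries v i + v j.
-- M has star tree rank at most r: M is the entrywise minimum of some
-- s star tree matrices with 1 ≤ s ≤ r (s = suc s').
StarTreeRankAtMost : ∀ {n} → Dissim n → ℕ → Set
StarTreeRankAtMost {n} M r = Σ ℕ λ s' → (suc s' ≤ r) ×
  Σ (Fin (suc s') → Fin n → ℚ) λ v →
    ∀ (i j : Fin n) → i ≢ j → ent M i j ≡ minFin (λ t → v t i +ℚ v t j)

module Submission where

-- Colour a pair {i,j} by whether M i j = 1.  Ramsey's theorem gives k
-- points K on which M is constant, equal to h + h with h ∈ {0, ½}.  Then
-- the following n − k + 1 star trees have entrywise minimum exactly M:
--   * the block star, with value h on K and 1 off K, realising every pair
--     inside K;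
--   * for each of the n − k points j outside K, the pointed star at j,
--     with value −1 at j and M i j + 1 at i ≠ j, realising every pair
--     containing j.
-- As all entries of M lie in [0,1], each of these stars dominates M.

open import Defs
open import Data.Nat using (ℕ; _≤_; _∸_; _+_; zero; suc)
import Data.Nat.Properties as ℕP
open import Data.Fin using (Fin; zero; suc; punchIn; punchOut)
open import Data.Fin.Properties
  using (_≟_; punchIn-punchOut; punchOut-punchIn; punchOut-cong; punchOut-injective; punchInᵢ≢i; suc-injective)
open import Data.Product using (Σ; ∃; _×_; _,_; proj₁; proj₂)
open import Data.Sum using (_⊎_; inj₁; inj₂; [_,_]′)
open import Data.Bool using (Bool; true; false)
open import Data.Empty using (⊥-elim)
open import Data.Unit using (tt)
open import Function.Definitions using (Injective)
open import Relation.Binary.PropositionalEquality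
  using (_≡_; _≢_; refl; sym; trans; cong; cong₂; module ≡-Reasoning)
open import Relation.Nullary using (Dec; yes; no; does)
open import Relation.Nullary.Decidable using (toWitness)
open import Data.Rational using (ℚ; 0ℚ; 1ℚ; ½; -_)
  renaming (_+_ to _+ℚ_; _≤_ to _≤ℚ_)
import Data.Rational.Properties as QP

minFin-≤ : ∀ {s} (F : Fin (suc s) → ℚ) t → minFin F ≤ℚ F t
minFin-≤ {zero} F zero = QP.≤-refl
minFin-≤ {suc s} F zero = QP.p⊓q≤p (F zero) _
minFin-≤ {suc s} F (suc t) =
  QP.≤-trans (QP.p⊓q≤q (F zero) _) (minFin-≤ (λ t → F (suc t)) t)

≤-minFin : ∀ {s} (F : Fin (suc s) → ℚ) {x} → (∀ t → x ≤ℚ F t) → x ≤ℚ minFin F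
≤-minFin {zero} F lower = lower zero
≤-minFin {suc s} F lower =
  QP.⊓-glb (lower zero) (≤-minFin (λ t → F (suc t)) (λ t → lower (suc t)))

minFin-attained : ∀ {s} (F : Fin (suc s) → ℚ) {x} →
  (∀ t → x ≤ℚ F t) → (∃ λ t → F t ≡ x) → minFin F ≡ x
minFin-attained F lower (t , Ft≡x) =
  QP.≤-antisym (QP.≤-trans (minFin-≤ F t) (QP.≤-reflexive Ft≡x)) (≤-minFin F lower)

Dominates : ∀ {n} → Dissim n → (Fin n → ℚ) → Set
Dominates {n} M w = ∀ (i j : Fin n) → i ≢ j → ent M i j ≤ℚ w i +ℚ w j

Realises : ∀ {n} → Dissim n → (Fin n → ℚ) → Fin n → Fin n → Set
Realises M w i j = w i +ℚ w j ≡ ent M i j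

realises-sym : ∀ {n} (M : Dissim n) (w : Fin n → ℚ) {i j} →
  Realises M w i j → Realises M w j i
realises-sym M w {i} {j} r = trans (QP.+-comm (w j) (w i)) (trans r (ent-sym M i j))

rank-from-stars : ∀ {n s} (M : Dissim n) r → suc s ≤ r →
  (v : Fin (suc s) → Fin n → ℚ) → (∀ t → Dominates M (v t)) →
  (∀ i j → i ≢ j → ∃ λ t → Realises M (v t) i j) → StarTreeRankAtMost M r
rank-from-stars {s = s} M r s<r v dominates realises =
  s , s<r , v , λ i j i≢j →
    sym (minFin-attained (λ t → v t i +ℚ v t j) (λ t → dominates t i j i≢j) (realises i j i≢j))

UnitEntries : ∀ {n} → Dissim n → Set
UnitEntries {n} M = ∀ (i j : Fin n) → i ≢ j → 0ℚ ≤ℚ ent M i j × ent M i j ≤ℚ 1ℚ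

0≤1 : 0ℚ ≤ℚ 1ℚ
0≤1 = toWitness {a? = 0ℚ QP.≤? 1ℚ} tt

zeroOne⇒unitEntries : ∀ {n} (M : Dissim n) → ZeroOne M → UnitEntries M
zeroOne⇒unitEntries M zeroOne i j i≢j with zeroOne i j i≢j
... | inj₁ Mij≡0 = QP.≤-reflexive (sym Mij≡0) , QP.≤-trans (QP.≤-reflexive Mij≡0) 0≤1
... | inj₂ Mij≡1 = QP.≤-trans 0≤1 (QP.≤-reflexive (sym Mij≡1)) , QP.≤-reflexive Mij≡1

p≤p+q : ∀ p {q} → 0ℚ ≤ℚ q → p ≤ℚ p +ℚ q
p≤p+q p {q} 0≤q = QP.≤-trans (QP.≤-reflexive (sym (QP.+-identityʳ p))) (QP.+-monoʳ-≤ p 0≤q)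

1≤p+1 : ∀ {p} → 0ℚ ≤ℚ p → 1ℚ ≤ℚ p +ℚ 1ℚ
1≤p+1 0≤p = QP.+-monoˡ-≤ 1ℚ 0≤p

pointStar : ∀ {n} → Dissim n → Fin n → Fin n → ℚ
pointStar M j i with i ≟ j
... | yes _ = - 1ℚ
... | no _ = ent M i j +ℚ 1ℚ

pointStar-centre : ∀ {n} (M : Dissim n) j → pointStar M j j ≡ - 1ℚ
pointStar-centre M j with j ≟ j
... | yes _ = refl
... | no j≢j = ⊥-elim (j≢j refl)

pointStar-off : ∀ {n} (M : Dissim n) {i j} → i ≢ j → pointStar M j i ≡ ent M i j +ℚ 1ℚ
pointStar-off M {i} {j} i≢j with i ≟ j
... | yes i≡j = ⊥-elim (i≢j i≡j)
... | no _ = refl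

pointStar-realises : ∀ {n} (M : Dissim n) {i j} → i ≢ j → Realises M (pointStar M j) i j
pointStar-realises M {i} {j} i≢j = begin
  pointStar M j i +ℚ pointStar M j j    ≡⟨ cong₂ _+ℚ_ (pointStar-off M i≢j) (pointStar-centre M j) ⟩
  (ent M i j +ℚ 1ℚ) +ℚ - 1ℚ             ≡⟨ QP.+-assoc (ent M i j) 1ℚ (- 1ℚ) ⟩
  ent M i j +ℚ (1ℚ +ℚ - 1ℚ)             ≡⟨ cong (ent M i j +ℚ_) (QP.+-inverseʳ 1ℚ) ⟩
  ent M i j +ℚ 0ℚ                       ≡⟨ QP.+-identityʳ (ent M i j) ⟩
  ent M i j                             ∎
  where open ≡-Reasoning

-- Off row j the pointed star has entries at least 2, so it dominates any
-- matrix with entries in [0,1].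
pointStar-dominates : ∀ {n} (M : Dissim n) → UnitEntries M → ∀ j → Dominates M (pointStar M j)
pointStar-dominates M unit j i l i≢l = byCases (i ≟ j) (l ≟ j)
  where
  byCases : Dec (i ≡ j) → Dec (l ≡ j) → ent M i l ≤ℚ pointStar M j i +ℚ pointStar M j l
  byCases (yes refl) _ =
    QP.≤-reflexive (sym (realises-sym M (pointStar M i) (pointStar-realises M (λ l≡i → i≢l (sym l≡i)))))
  byCases (no _) (yes refl) = QP.≤-reflexive (sym (pointStar-realises M i≢l))
  byCases (no i≢j) (no l≢j) = begin
    ent M i l                                   ≤⟨ proj₂ (unit i l i≢l) ⟩
    1ℚ                                          ≤⟨ 1≤p+1 (proj₁ (unit i j i≢j)) ⟩
    ent M i j +ℚ 1ℚ                             ≤⟨ p≤p+q _ (QP.≤-trans 0≤1 (1≤p+1 (proj₁ (unit l j l≢j)))) ⟩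
    (ent M i j +ℚ 1ℚ) +ℚ (ent M l j +ℚ 1ℚ)      ≡⟨ cong₂ _+ℚ_ (sym (pointStar-off M i≢j)) (sym (pointStar-off M l≢j)) ⟩
    pointStar M j i +ℚ pointStar M j l          ∎
    where open QP.≤-Reasoning

Image : ∀ {k n} → (Fin k → Fin n) → Fin n → Set
Image f j = ∃ λ a → f a ≡ j

record Complement {k s n} (f : Fin k → Fin n) (g : Fin s → Fin n) : Set where
  field
    covers : ∀ j → Image f j ⊎ Image g j
    disjoint : ∀ t a → g t ≢ f a

-- Induction on k: delete f zero from the codomain with
-- punchOut, enumerate the complement for the remaining values, and punch
-- f zero back in.
complement : ∀ {k n} (f : Fin k → Fin n) → Injective _≡_ _≡_ f →
  Σ (Fin (n ∸ k) → Fin n) (Complement f)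
complement {zero} f _ =
  (λ t → t) , record { covers = λ j → inj₂ (j , refl) ; disjoint = λ t () }
complement {suc k} {zero} f _ with f zero
... | ()
complement {suc k} {suc n} f inj = g , record { covers = covers ; disjoint = disjoint }
  where
  x : Fin (suc n)
  x = f zero

  x≢f-suc : ∀ a → x ≢ f (suc a)
  x≢f-suc a x≡fa with inj x≡fa
  ... | ()

  f′ : Fin k → Fin n
  f′ a = punchOut (x≢f-suc a)

  f′-injective : Injective _≡_ _≡_ f′
  f′-injective {a} {b} eq = suc-injective (inj (punchOut-injective (x≢f-suc a) (x≢f-suc b) eq))

  g′ : Fin (n ∸ k) → Fin n
  g′ = proj₁ (complement f′ f′-injective)

  open Complement (proj₂ (complement f′ f′-injective))
    renaming (covers to covers′; disjoint to disjoint′)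

  g : Fin (n ∸ k) → Fin (suc n)
  g t = punchIn x (g′ t)

  covers : ∀ j → Image f j ⊎ Image g j
  covers j with x ≟ j
  ... | yes x≡j = inj₁ (zero , x≡j)
  ... | no x≢j with covers′ (punchOut x≢j)
  ...   | inj₁ (a , eq) = inj₁ (suc a , punchOut-injective (x≢f-suc a) x≢j eq)
  ...   | inj₂ (t , eq) = inj₂ (t , trans (cong (punchIn x) eq) (punchIn-punchOut x≢j))

  disjoint : ∀ t a → g t ≢ f a
  disjoint t zero gt≡x = punchInᵢ≢i x (g′ t) gt≡x
  disjoint t (suc a) gt≡fa =
    disjoint′ t a (trans (sym (punchOut-punchIn x)) (punchOut-cong x gt≡fa))

ConstantOn : ∀ {n k} → Dissim n → (Fin k → Fin n) → ℚ → Set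
ConstantOn {k = k} M f c = ∀ (a a′ : Fin k) → a ≢ a′ → ent M (f a) (f a′) ≡ c

module BlockStar {n k s} (M : Dissim n) {f : Fin k → Fin n} {g : Fin s → Fin n}
                 (C : Complement f g) (h : ℚ) where
  open Complement C

  blockStar : Fin n → ℚ
  blockStar i = [ (λ _ → h) , (λ _ → 1ℚ) ]′ (covers i)

  blockStar-on : ∀ a → blockStar (f a) ≡ h
  blockStar-on a with covers (f a)
  ... | inj₁ _ = refl
  ... | inj₂ (t , gt≡fa) = ⊥-elim (disjoint t a gt≡fa)

  blockStar-off : ∀ {j} → Image g j → blockStar j ≡ 1ℚ
  blockStar-off {j} (t , gt≡j) with covers j
  ... | inj₁ (a , fa≡j) = ⊥-elim (disjoint t a (trans gt≡j (sym fa≡j)))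
  ... | inj₂ _ = refl

  blockStar-nonneg : 0ℚ ≤ℚ h → ∀ i → 0ℚ ≤ℚ blockStar i
  blockStar-nonneg 0≤h i with covers i
  ... | inj₁ _ = 0≤h
  ... | inj₂ _ = 0≤1

  blockStar-realises : ConstantOn M f (h +ℚ h) →
    ∀ {a a′} → a ≢ a′ → Realises M blockStar (f a) (f a′)
  blockStar-realises constant {a} {a′} a≢a′ =
    trans (cong₂ _+ℚ_ (blockStar-on a) (blockStar-on a′)) (sym (constant a a′ a≢a′))

  -- Pairs meeting the complement are dominated because the star is 1 there.
  blockStar-dominates : UnitEntries M → 0ℚ ≤ℚ h → ConstantOn M f (h +ℚ h) →
    Dominates M blockStar
  blockStar-dominates unit 0≤h constant i j i≢j = byCases (covers i) (covers j)
    where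
    Mij≤1 : ent M i j ≤ℚ 1ℚ
    Mij≤1 = proj₂ (unit i j i≢j)

    byCases : Image f i ⊎ Image g i → Image f j ⊎ Image g j →
      ent M i j ≤ℚ blockStar i +ℚ blockStar j
    byCases (inj₁ (a , refl)) (inj₁ (a′ , refl)) =
      QP.≤-reflexive (sym (blockStar-realises constant (λ a≡a′ → i≢j (cong f a≡a′))))
    byCases (inj₂ i-off) _ = QP.≤-trans Mij≤1
      (QP.≤-trans (p≤p+q 1ℚ (blockStar-nonneg 0≤h j))
        (QP.≤-reflexive (cong (_+ℚ blockStar j) (sym (blockStar-off i-off)))))
    byCases (inj₁ _) (inj₂ j-off) = QP.≤-trans Mij≤1
      (QP.≤-trans (1≤p+1 (blockStar-nonneg 0≤h i))
        (QP.≤-reflexive (cong (blockStar i +ℚ_) (sym (blockStar-off j-off)))))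

constantBlock⇒rank : ∀ {n k} (M : Dissim n) → UnitEntries M →
  (f : Fin k → Fin n) → Injective _≡_ _≡_ f → (h : ℚ) → 0ℚ ≤ℚ h →
  ConstantOn M f (h +ℚ h) → StarTreeRankAtMost M (n ∸ k + 1)
constantBlock⇒rank {n} {k} M unit f inj h 0≤h constant =
  rank-from-stars M (n ∸ k + 1) (ℕP.≤-reflexive (ℕP.+-comm 1 (n ∸ k))) stars dominates realises
  where
  g : Fin (n ∸ k) → Fin n
  g = proj₁ (complement f inj)

  C : Complement f g
  C = proj₂ (complement f inj)

  open Complement C
  open BlockStar M C h

  stars : Fin (suc (n ∸ k)) → Fin n → ℚ
  stars zero = blockStar
  stars (suc t) = pointStar M (g t)

  dominates : ∀ t → Dominates M (stars t)
  dominates zero = blockStar-dominates unit 0≤h constant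
  dominates (suc t) = pointStar-dominates M unit (g t)

  realisesBy : ∀ {i j} → i ≢ j → Image f i ⊎ Image g i → Image f j ⊎ Image g j →
    ∃ λ t → Realises M (stars t) i j
  realisesBy i≢j (inj₂ (t , refl)) _ =
    suc t , realises-sym M (pointStar M (g t)) (pointStar-realises M (λ j≡i → i≢j (sym j≡i)))
  realisesBy i≢j (inj₁ _) (inj₂ (t , refl)) = suc t , pointStar-realises M i≢j
  realisesBy i≢j (inj₁ (a , refl)) (inj₁ (a′ , refl)) =
    zero , blockStar-realises constant (λ a≡a′ → i≢j (cong f a≡a′))

  realises : ∀ i j → i ≢ j → ∃ λ t → Realises M (stars t) i j
  realises i j i≢j = realisesBy i≢j (covers i) (covers j)

isOne : ℚ → Bool
isOne q = does (q QP.≟ 1ℚ)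

isOne-true : ∀ q → isOne q ≡ true → q ≡ 1ℚ
isOne-true q isOne≡true with q QP.≟ 1ℚ
... | yes q≡1 = q≡1
isOne-true q () | no _

isOne-false : ∀ q → isOne q ≡ false → q ≢ 1ℚ
isOne-false q isOne≡false with q QP.≟ 1ℚ
isOne-false q () | yes _
... | no q≢1 = q≢1

onesGraph : ∀ {n} → Dissim n → Graph n
onesGraph M = record
  { adj = λ i j → isOne (ent M i j)
  ; adj-sym = λ i j → cong isOne (ent-sym M i j) }

ConstantBlock : ∀ {n} → Dissim n → ℕ → Set
ConstantBlock {n} M k = Σ (Fin k → Fin n) λ f → Injective _≡_ _≡_ f ×
  Σ ℚ λ h → 0ℚ ≤ℚ h × ConstantOn M f (h +ℚ h)

-- For a 0/1 matrix, a clique of the ones graph is a block with constant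
-- value 1 = ½ + ½, and an independent set one with constant value 0 = 0 + 0.
homogeneous⇒constantBlock : ∀ {n k} (M : Dissim n) → ZeroOne M →
  HasClique (onesGraph M) k ⊎ HasIndep (onesGraph M) k → ConstantBlock M k
homogeneous⇒constantBlock M zeroOne (inj₁ (f , inj , adjacent)) =
  f , inj , ½ , toWitness {a? = 0ℚ QP.≤? ½} tt ,
  λ a a′ a≢a′ → isOne-true _ (adjacent a a′ a≢a′)
homogeneous⇒constantBlock M zeroOne (inj₂ (f , inj , nonadjacent)) =
  f , inj , 0ℚ , QP.≤-refl , zero-entry
  where
  zero-entry : ConstantOn M f (0ℚ +ℚ 0ℚ)
  zero-entry a a′ a≢a′ with zeroOne (f a) (f a′) (λ fa≡fa′ → a≢a′ (inj fa≡fa′))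
  ... | inj₁ Maa′≡0 = Maa′≡0
  ... | inj₂ Maa′≡1 = ⊥-elim (isOne-false _ (nonadjacent a a′ a≢a′) Maa′≡1)

proposition4p5 : (k R n : ℕ) → 1 ≤ k → IsRamseyNumber k R → R ≤ n →
    (M : Dissim n) → ZeroOne M → StarTreeRankAtMost M (n ∸ k + 1)
proposition4p5 k R n _ (ramsey , _) R≤n M zeroOne
  with homogeneous⇒constantBlock M zeroOne (ramsey n R≤n (onesGraph M))
... | f , inj , h , 0≤h , constant =
  constantBlock⇒rank M (zeroOne⇒unitEntries M zeroOne) f inj h 0≤h constant
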